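{- Let $\mathbf f=f_1f_2f_3\dots$ be the Fibonacci word over $\{0,1\}$ and $(F_n)_{n\ge0}$ the Fibonacci sequence. For every $n\ge4$: (1) the word $f_1\dots f_{F_n}\,f_1\dots f_{F_n}\,f_1\dots f_{F_{n-1}-2}$, of length $F_{n+2}-2$, is the longest common prefix of $\mathbf f$ and the periodic word $(f_1\dots f_{F_n})^\infty$; (2) the word $f_1\dots f_{F_{n+1}}\,f_1\dots f_{F_n}\,f_1\dots f_{F_n}\,f_1\dots f_{F_n}\,f_1\dots f_{F_{n-1}-2}$, of length $2F_{n+2}-2$, is the longest common prefix of $\mathbf f$ and the word $f_1\dots f_{F_{n+1}}(f_1\dots f_{F_n})^\infty$.
   Context: The Fibonacci word $\mathbf f$ is the fixed point of the substitution $0\mapsto01$, $1\mapsto0$ (equivalently, the limit of the words $0,01,010,01001,\dots$, each obtained by concatenating the two preceding ones); it begins $010010100100101001010\dots$. The Fibonacci sequence is given by $F_0=0$, $F_1=1$, $F_{n+2}=F_{n+1}+F_n$. For a finite word $w$, $w^\infty$ denotes the infinite word $www\cdots$. -}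

module Defs where

open import Data.Nat using (ℕ; zero; suc; _+_; _∸_; _<_; _<ᵇ_; _%_)
open import Data.Bool using (if_then_else_)
open import Data.List using (List; []; _∷_; _++_; length; map; upTo; lookup)
open import Data.Fin using (fromℕ<)
open import Data.Product using (_×_)
open import Relation.Binary.PropositionalEquality using (_≡_; _≢_)

F : ℕ → ℕ
F zero = zero
F (suc zero) = suc zero
F (suc (suc n)) = F (suc n) + F n

-- Finite Fibonacci words s 0 = 0, s 1 = 01, s (k+2) = s (k+1) s k
-- (letters 0,1 represented as natural numbers); |s k| = F (k+2).
fibW : ℕ → List ℕ
fibW zero = 0 ∷ []
fibW (suc zero) = 0 ∷ 1 ∷ []
fibW (suc (suc k)) = fibW (suc k) ++ fibW k

-- i-th letter of a list (0-indexed), with a default for out-of-range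
-- indices (never used below, since |fibW i| = F (i+2) > i).
nth : List ℕ → ℕ → ℕ
nth [] _ = 0
nth (x ∷ xs) zero = x
nth (x ∷ xs) (suc i) = nth xs i

-- The infinite Fibonacci word, 0-indexed: fib i = f_{i+1}.
-- Each fibW k is a prefix of fibW (k+1), so this is the limit word.
fib : ℕ → ℕ
fib i = nth (fibW i) i

pref : ℕ → List ℕ
pref k = map fib (upTo k)

-- (f_1 … f_{F n})^∞, 0-indexed (F n > 0 for n ≥ 1).
per1 : (n : ℕ) → ℕ → ℕ
per1 n i = fib (i % suc (F n ∸ 1))

-- f_1 … f_{F (n+1)} (f_1 … f_{F n})^∞, 0-indexed.
per2 : (n : ℕ) → ℕ → ℕ
per2 n i = if i <ᵇ F (suc n) then fib i else per1 n (i ∸ F (suc n))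

IsLCP : (ℕ → ℕ) → (ℕ → ℕ) → List ℕ → Set
IsLCP u v w =
  ((i : ℕ) (lt : i < length w) →
     (lookup w (fromℕ< lt) ≡ u i) × (lookup w (fromℕ< lt) ≡ v i))
  × (u (length w) ≢ v (length w))

word1 : ℕ → List ℕ
word1 n = pref (F n) ++ pref (F n) ++ pref (F (n ∸ 1) ∸ 2)

word2 : ℕ → List ℕ
word2 n = pref (F (suc n)) ++ pref (F n) ++ pref (F n) ++ pref (F n)
          ++ pref (F (n ∸ 1) ∸ 2)

-- Write A = s (k+1) and B = s k for consecutive finite Fibonacci words.
-- BA and AB differ only in their last two letters, which are swapped.
-- Since 𝐟 begins with s (k+3) = A·BA and with s (k+2) = AB, the shift of 𝐟
-- by |A| = F (k+3) agrees with 𝐟 for exactly |AB| − 2 = F (k+4) − 2 letters.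
-- Part (1) is this fact at k+3 = n: the F n-periodic word generated by
-- f₁…f_{F n} agrees with 𝐟 up to F n + F (n+1) − 2 = F (n+2) − 2.
-- For part (2), 𝐟 and f₁…f_{F (n+1)} (f₁…f_{F n})^∞ share the first F (n+1)
-- letters; after them 𝐟 continues with its own prefix of length F n (shift
-- by F (n+1)), and then restarts 𝐟 once more (shift by F (n+2)) for longer
-- than needed, so the comparison reduces to part (1).
module Submission where

open import Defs
open import Data.Nat using (ℕ; zero; suc; _+_; _*_; _∸_; _≤_; _<_; _<ᵇ_; _%_; s≤s)
open import Data.Nat.Properties
open import Data.Nat.DivMod using ([m+n]%n≡m%n; m<n⇒m%n≡m)
open import Data.Bool using (true; false; T)
open import Data.Bool.Properties using (T-≡)
open import Data.List using (List; []; _∷_; _++_; length; map; upTo; applyUpTo; lookup)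
open import Data.List.Properties using (length-++; length-map; length-upTo; ++-assoc; ++-identityʳ)
open import Data.Fin using (fromℕ<)
open import Data.Product using (_×_; _,_; ∃; proj₁)
open import Data.Sum using (inj₁; inj₂)
open import Function using (Equivalence)
open import Relation.Nullary using (yes; no; contradiction)
open import Relation.Binary.PropositionalEquality
  using (_≡_; _≢_; refl; sym; trans; cong; cong₂; subst; module ≡-Reasoning)

open ≡-Reasoning

AgreeBelow : (ℕ → ℕ) → (ℕ → ℕ) → ℕ → Set
AgreeBelow u v N = ∀ i → i < N → u i ≡ v i

DifferFirstAt : (ℕ → ℕ) → (ℕ → ℕ) → ℕ → Set
DifferFirstAt u v N = AgreeBelow u v N × u N ≢ v N

PrefixOf : List ℕ → (ℕ → ℕ) → Set
PrefixOf w u = AgreeBelow (nth w) u (length w)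

Periodic : ℕ → (ℕ → ℕ) → Set
Periodic p v = ∀ j → v (p + j) ≡ v j

agreeBelow-trans : ∀ {u v w N} → AgreeBelow u v N → AgreeBelow v w N → AgreeBelow u w N
agreeBelow-trans uv vw i i<N = trans (uv i i<N) (vw i i<N)

agreeBelow-≤ : ∀ {u v M N} → N ≤ M → AgreeBelow u v M → AgreeBelow u v N
agreeBelow-≤ N≤M uv i i<N = uv i (<-≤-trans i<N N≤M)

agreeBelow-suc : ∀ {u v N} → AgreeBelow u v N → u N ≡ v N → AgreeBelow u v (suc N)
agreeBelow-suc uv eq i i<1+N with m<1+n⇒m<n∨m≡n i<1+N
... | inj₁ i<N = uv i i<N
... | inj₂ refl = eq

agreeBelow-+ : ∀ {u v} p {N} → AgreeBelow u v p →
               AgreeBelow (λ j → u (p + j)) (λ j → v (p + j)) N → AgreeBelow u v (p + N)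
agreeBelow-+ p uv-low uv-high i i<p+N with i <? p
... | yes i<p = uv-low i i<p
... | no i≮p with m≤n⇒∃[o]m+o≡n (≮⇒≥ i≮p)
...   | j , refl = uv-high j (+-cancelˡ-< p j _ i<p+N)

differFirstAt-cong : ∀ {u u′ v v′ N} → DifferFirstAt u v N →
                     AgreeBelow u u′ (suc N) → AgreeBelow v v′ (suc N) → DifferFirstAt u′ v′ N
differFirstAt-cong {N = N} (uv , u≢v) uu′ vv′ =
  (λ i i<N → trans (sym (uu′ i (m<n⇒m<1+n i<N))) (trans (uv i i<N) (vv′ i (m<n⇒m<1+n i<N)))) ,
  (λ u′≡v′ → u≢v (trans (uu′ N ≤-refl) (trans u′≡v′ (sym (vv′ N ≤-refl)))))

differFirstAt-+ : ∀ {u v} p {N} → AgreeBelow u v p →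
                  DifferFirstAt (λ j → u (p + j)) (λ j → v (p + j)) N → DifferFirstAt u v (p + N)
differFirstAt-+ p uv-low (uv-high , u≢v) = agreeBelow-+ p uv-low uv-high , u≢v

module _ {g v : ℕ → ℕ} {p : ℕ} (0<p : 0 < p) (v-periodic : Periodic p v) (gv : AgreeBelow g v p) where

  periodic-agreeBelow : ∀ {L} → AgreeBelow (λ j → g (p + j)) g L → AgreeBelow g v (p + L)
  periodic-agreeBelow {L} g-shift = go (p + L) ≤-refl
    where
    go : ∀ N → N ≤ p + L → AgreeBelow g v N
    go zero _ = λ _ ()
    go (suc N) N<p+L = agreeBelow-suc (go N (<⇒≤ N<p+L)) (at N ≤-refl N<p+L)
      where
      at : ∀ i → i ≤ N → i < p + L → g i ≡ v i
      at i i≤N i<p+L with i <? p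
      ... | yes i<p = gv i i<p
      ... | no i≮p with m≤n⇒∃[o]m+o≡n (≮⇒≥ i≮p)
      ...   | j , refl = begin
        g (p + j)  ≡⟨ g-shift j (+-cancelˡ-< p j L i<p+L) ⟩
        g j        ≡⟨ go N (<⇒≤ N<p+L) j (<-≤-trans (m<n+m j 0<p) i≤N) ⟩
        v j        ≡⟨ sym (v-periodic j) ⟩
        v (p + j)  ∎

  periodic-differFirstAt : ∀ {L} → DifferFirstAt (λ j → g (p + j)) g L → DifferFirstAt g v (p + L)
  periodic-differFirstAt {L} (g-shift , g≢) = agree , λ eq →
    g≢ (trans eq (trans (v-periodic L) (sym (agree L (m<n+m L 0<p)))))
    where
    agree : AgreeBelow g v (p + L)
    agree = periodic-agreeBelow g-shift

nth-++ˡ : ∀ (xs ys : List ℕ) i → i < length xs → nth (xs ++ ys) i ≡ nth xs i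
nth-++ˡ (x ∷ xs) ys zero _ = refl
nth-++ˡ (x ∷ xs) ys (suc i) (s≤s i<) = nth-++ˡ xs ys i i<

nth-++ʳ : ∀ (xs ys : List ℕ) j → nth (xs ++ ys) (length xs + j) ≡ nth ys j
nth-++ʳ [] ys j = refl
nth-++ʳ (x ∷ xs) ys j = nth-++ʳ xs ys j

nth-++-length : ∀ (xs : List ℕ) {y ys} → nth (xs ++ y ∷ ys) (length xs) ≡ y
nth-++-length [] = refl
nth-++-length (x ∷ xs) = nth-++-length xs

nth-lookup : ∀ (w : List ℕ) i (i< : i < length w) → lookup w (fromℕ< i<) ≡ nth w i
nth-lookup (x ∷ w) zero (s≤s _) = refl
nth-lookup (x ∷ w) (suc i) (s≤s i<) = nth-lookup w i i<

nth-map-applyUpTo : ∀ (g h : ℕ → ℕ) c i → i < c → nth (map g (applyUpTo h c)) i ≡ g (h i)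
nth-map-applyUpTo g h (suc c) zero _ = refl
nth-map-applyUpTo g h (suc c) (suc i) (s≤s i<c) = nth-map-applyUpTo g (λ k → h (suc k)) c i i<c

length-pref : ∀ c → length (pref c) ≡ c
length-pref c = trans (length-map fib (upTo c)) (length-upTo c)

pref-prefixOf : ∀ {v} c → AgreeBelow fib v c → PrefixOf (pref c) v
pref-prefixOf c fv i i< =
  let i<c = subst (i <_) (length-pref c) i< in trans (nth-map-applyUpTo fib (λ k → k) c i i<c) (fv i i<c)

prefixOf-++ : ∀ {u p} xs ys → length xs ≡ p → PrefixOf xs u → PrefixOf ys (λ j → u (p + j)) →
              PrefixOf (xs ++ ys) u
prefixOf-++ xs ys refl xs⊑u ys⊑u i i<
  = agreeBelow-+ (length xs)
      (λ i i<xs → trans (nth-++ˡ xs ys i i<xs) (xs⊑u i i<xs))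
      (λ j j<ys → trans (nth-++ʳ xs ys j) (ys⊑u j j<ys))
      i (subst (i <_) (length-++ xs) i<)

prefixOf-++-periodic : ∀ {p v} xs ys → length xs ≡ p → Periodic p v →
                       PrefixOf xs v → PrefixOf ys v → PrefixOf (xs ++ ys) v
prefixOf-++-periodic xs ys length-xs v-periodic xs⊑v ys⊑v =
  prefixOf-++ xs ys length-xs xs⊑v (λ j j< → trans (ys⊑v j j<) (sym (v-periodic j)))

isLCP : ∀ {u v} w → PrefixOf w v → DifferFirstAt u v (length w) → IsLCP u v w
isLCP w w⊑v (uv , u≢v) =
  (λ i i< → trans (nth-lookup w i i<) (trans (w⊑v i i<) (sym (uv i i<))) ,
            trans (nth-lookup w i i<) (w⊑v i i<)) ,
  u≢v

1≤F[1+k] : ∀ k → 1 ≤ F (suc k)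
1≤F[1+k] zero = ≤-refl
1≤F[1+k] (suc k) = ≤-trans (1≤F[1+k] k) (m≤m+n _ _)

2≤F[3+k] : ∀ k → 2 ≤ F (3 + k)
2≤F[3+k] k = +-mono-≤ (1≤F[1+k] (suc k)) (1≤F[1+k] k)

k<F[2+k] : ∀ k → k < F (2 + k)
k<F[2+k] zero = ≤-refl
k<F[2+k] (suc k) = subst (_< F (3 + k)) (+-comm k 1) (+-mono-<-≤ (k<F[2+k] k) (1≤F[1+k] k))

length-fibW : ∀ k → length (fibW k) ≡ F (2 + k)
length-fibW zero = refl
length-fibW (suc zero) = refl
length-fibW (suc (suc k)) =
  trans (length-++ (fibW (suc k))) (cong₂ _+_ (length-fibW (suc k)) (length-fibW k))

fibW-extends : ∀ k → ∃ λ t → fibW (suc k) ≡ fibW k ++ t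
fibW-extends zero = 1 ∷ [] , refl
fibW-extends (suc k) = fibW k , refl

fibW-prefix : ∀ {k} k′ → k ≤ k′ → ∃ λ t → fibW k′ ≡ fibW k ++ t
fibW-prefix k′ k≤k′ with m≤n⇒m<n∨m≡n k≤k′
fibW-prefix k′ _ | inj₂ refl = [] , sym (++-identityʳ _)
fibW-prefix {k} (suc k′) _ | inj₁ (s≤s k≤k′) with fibW-prefix k′ k≤k′ | fibW-extends k′
... | t , eq | t′ , eq′ = t ++ t′ , (begin
  fibW (suc k′)          ≡⟨ eq′ ⟩
  fibW k′ ++ t′          ≡⟨ cong (_++ t′) eq ⟩
  (fibW k ++ t) ++ t′    ≡⟨ ++-assoc (fibW k) t t′ ⟩
  fibW k ++ (t ++ t′)    ∎)

nth-fibW-≤ : ∀ {k k′} i → k ≤ k′ → i < length (fibW k) → nth (fibW k′) i ≡ nth (fibW k) i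
nth-fibW-≤ {k} {k′} i k≤k′ i< with fibW-prefix k′ k≤k′
... | t , eq = trans (cong (λ w → nth w i) eq) (nth-++ˡ (fibW k) t i i<)

fib-fibW : ∀ k i → i < length (fibW k) → fib i ≡ nth (fibW k) i
fib-fibW k i i< with ≤-total i k
... | inj₁ i≤k = sym (nth-fibW-≤ i i≤k (subst (i <_) (sym (length-fibW i)) (k<F[2+k] i)))
... | inj₂ k≤i = nth-fibW-≤ i k≤i i<

fib-fibW-++ : ∀ k xs ys → fibW k ≡ xs ++ ys → ∀ j → j < length ys → fib (length xs + j) ≡ nth ys j
fib-fibW-++ k xs ys eq j j< = begin
  fib (length xs + j)                ≡⟨ fib-fibW k _ (subst (_ <_) (sym (cong length eq)) bound) ⟩
  nth (fibW k) (length xs + j)       ≡⟨ cong (λ w → nth w (length xs + j)) eq ⟩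
  nth (xs ++ ys) (length xs + j)     ≡⟨ nth-++ʳ xs ys j ⟩
  nth ys j                           ∎
  where
  bound : length xs + j < length (xs ++ ys)
  bound = subst (_ <_) (sym (length-++ xs)) (+-monoʳ-< (length xs) j<)

record LastTwoSwapped (xs ys : List ℕ) : Set where
  field
    stem : List ℕ
    x y : ℕ
    x≢y : x ≢ y
    xs-shape : xs ≡ stem ++ x ∷ y ∷ []
    ys-shape : ys ≡ stem ++ y ∷ x ∷ []

lastTwoSwapped-sym : ∀ {xs ys} → LastTwoSwapped xs ys → LastTwoSwapped ys xs
lastTwoSwapped-sym s = record
  { stem = stem ; x = y ; y = x ; x≢y = λ eq → x≢y (sym eq) ; xs-shape = ys-shape ; ys-shape = xs-shape }
  where open LastTwoSwapped s

lastTwoSwapped-++ : ∀ zs {xs ys} → LastTwoSwapped xs ys → LastTwoSwapped (zs ++ xs) (zs ++ ys)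
lastTwoSwapped-++ zs s = record
  { stem = zs ++ stem ; x = x ; y = y ; x≢y = x≢y
  ; xs-shape = trans (cong (zs ++_) xs-shape) (sym (++-assoc zs stem _))
  ; ys-shape = trans (cong (zs ++_) ys-shape) (sym (++-assoc zs stem _)) }
  where open LastTwoSwapped s

lastTwoSwapped-differFirstAt : ∀ {xs ys} (s : LastTwoSwapped xs ys) →
  DifferFirstAt (nth xs) (nth ys) (length (LastTwoSwapped.stem s))
lastTwoSwapped-differFirstAt s rewrite LastTwoSwapped.xs-shape s | LastTwoSwapped.ys-shape s =
  (λ i i< → trans (nth-++ˡ stem _ i i<) (sym (nth-++ˡ stem _ i i<))) ,
  (λ eq → x≢y (trans (sym (nth-++-length stem)) (trans eq (nth-++-length stem))))
  where open LastTwoSwapped s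

fibW-lastTwoSwapped : ∀ k → LastTwoSwapped (fibW k ++ fibW (suc k)) (fibW (suc k) ++ fibW k)
fibW-lastTwoSwapped zero = record
  { stem = 0 ∷ [] ; x = 0 ; y = 1 ; x≢y = λ () ; xs-shape = refl ; ys-shape = refl }
fibW-lastTwoSwapped (suc k) =
  subst (LastTwoSwapped (fibW (suc k) ++ fibW (2 + k))) (sym (++-assoc (fibW (suc k)) (fibW k) _))
    (lastTwoSwapped-++ (fibW (suc k)) (lastTwoSwapped-sym (fibW-lastTwoSwapped k)))

fib-shift-differFirstAt : ∀ k → DifferFirstAt (λ j → fib (F (3 + k) + j)) fib (F (4 + k) ∸ 2)
fib-shift-differFirstAt k =
  subst (DifferFirstAt (λ j → fib (F (3 + k) + j)) fib) length-stem
    (differFirstAt-cong (lastTwoSwapped-differFirstAt swapped)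
      (λ j j< → sym (subst (λ a → fib (a + j) ≡ nth (B ++ A) j) (length-fibW (suc k))
                      (fib-fibW-++ (3 + k) A (B ++ A) (++-assoc A B A) j (in-range j j<))))
      (λ j j< → sym (fib-fibW-++ (2 + k) [] (A ++ B) refl j
                      (subst (j <_) (length-++-comm B A) (in-range j j<)))))
  where
  A B : List ℕ
  A = fibW (suc k)
  B = fibW k
  swapped : LastTwoSwapped (B ++ A) (A ++ B)
  swapped = fibW-lastTwoSwapped k
  open LastTwoSwapped swapped using (stem; xs-shape)
  length-stem+2 : length stem + 2 ≡ length (B ++ A)
  length-stem+2 = sym (trans (cong length xs-shape) (length-++ stem))
  length-++-comm : ∀ xs ys → length (xs ++ ys) ≡ length (ys ++ xs)
  length-++-comm xs ys = trans (length-++ xs) (trans (+-comm (length xs) _) (sym (length-++ ys)))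
  in-range : ∀ j → j < suc (length stem) → j < length (B ++ A)
  in-range j j< = subst (j <_) length-stem+2
    (<-≤-trans j< (subst (suc (length stem) ≤_) (+-comm 2 (length stem)) (n≤1+n _)))
  length-stem : length stem ≡ F (4 + k) ∸ 2
  length-stem = begin
    length stem                  ≡⟨ m+n∸n≡m (length stem) 2 ⟨
    (length stem + 2) ∸ 2        ≡⟨ cong (_∸ 2) length-stem+2 ⟩
    length (B ++ A) ∸ 2          ≡⟨ cong (_∸ 2) (length-++-comm B A) ⟩
    length (A ++ B) ∸ 2          ≡⟨ cong (_∸ 2) (trans (length-++ A) (cong₂ _+_ (length-fibW (suc k)) (length-fibW k))) ⟩
    F (4 + k) ∸ 2                ∎

F-add-∸2 : ∀ k → F (2 + k) + (F (3 + k) ∸ 2) ≡ F (4 + k) ∸ 2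
F-add-∸2 k = trans (sym (+-∸-assoc (F (2 + k)) (2≤F[3+k] k))) (cong (_∸ 2) (+-comm (F (2 + k)) _))

x+[x∸2]≡2x∸2 : ∀ {x} → 2 ≤ x → x + (x ∸ 2) ≡ 2 * x ∸ 2
x+[x∸2]≡2x∸2 {x} 2≤x = trans (sym (+-∸-assoc x 2≤x)) (cong (λ y → x + y ∸ 2) (sym (+-identityʳ x)))

per1-periodic : ∀ n → 0 < F n → Periodic (F n) (per1 n)
per1-periodic n 0<Fn j = cong fib (mod-shift (F n) 0<Fn)
  where
  mod-shift : ∀ p → 0 < p → (p + j) % suc (p ∸ 1) ≡ j % suc (p ∸ 1)
  mod-shift (suc p) _ = trans (cong (_% suc p) (+-comm (suc p) j)) ([m+n]%n≡m%n j (suc p))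

fib-per1 : ∀ n → AgreeBelow fib (per1 n) (F n)
fib-per1 n j j< = cong fib (sym (mod-below (F n) j<))
  where
  mod-below : ∀ p → j < p → j % suc (p ∸ 1) ≡ j
  mod-below (suc p) j< = m<n⇒m%n≡m j<

fib-per2 : ∀ n → AgreeBelow fib (per2 n) (F (suc n))
fib-per2 n i i< rewrite Equivalence.to T-≡ (<⇒<ᵇ i<) = refl

per2-shift : ∀ n j → per2 n (F (suc n) + j) ≡ per1 n j
per2-shift n j with F (suc n) + j <ᵇ F (suc n) in eq
... | true = contradiction (<ᵇ⇒< (F (suc n) + j) (F (suc n)) (subst T (sym eq) _)) (m+n≮m _ j)
... | false = cong (per1 n) (m+n∸m≡n (F (suc n)) j)

module _ (m : ℕ) where
  private
    n a c ℓ : ℕ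
    n = 4 + m
    a = F n
    c = F (3 + m) ∸ 2
    ℓ = F (5 + m) ∸ 2
    0<a : 0 < a
    0<a = 1≤F[1+k] (3 + m)

  per1-differFirstAt : DifferFirstAt fib (per1 n) (a + ℓ)
  per1-differFirstAt =
    periodic-differFirstAt 0<a (per1-periodic n 0<a) (fib-per1 n) (fib-shift-differFirstAt (suc m))

  word1-prefixOf : PrefixOf (word1 n) (per1 n)
  word1-prefixOf =
    prefixOf-++-periodic (pref a) (pref a ++ pref c) (length-pref a) (per1-periodic n 0<a) first-period
      (prefixOf-++-periodic (pref a) (pref c) (length-pref a) (per1-periodic n 0<a) first-period
        (pref-prefixOf c (agreeBelow-≤ c≤a (fib-per1 n))))
    where
    first-period : PrefixOf (pref a) (per1 n)
    first-period = pref-prefixOf a (fib-per1 n)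
    c≤a : c ≤ a
    c≤a = ≤-trans (m∸n≤m (F (3 + m)) 2) (m≤m+n (F (3 + m)) (F (2 + m)))

  length-word1 : length (word1 n) ≡ a + ℓ
  length-word1 = begin
    length (word1 n)                             ≡⟨ length-++ (pref a) ⟩
    length (pref a) + length (pref a ++ pref c)  ≡⟨ cong₂ _+_ (length-pref a) (length-++ (pref a)) ⟩
    a + (length (pref a) + length (pref c))      ≡⟨ cong (a +_) (cong₂ _+_ (length-pref a) (length-pref c)) ⟩
    a + (a + c)                                  ≡⟨ cong (a +_) (+-∸-assoc a (2≤F[3+k] m)) ⟨
    a + ℓ                                        ∎

  per2-differFirstAt : DifferFirstAt fib (per2 n) (F (5 + m) + (a + (a + ℓ)))
  per2-differFirstAt =
    differFirstAt-+ (F (5 + m)) (fib-per2 n)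
      (differFirstAt-cong
        (differFirstAt-+ a
          (agreeBelow-trans (agreeBelow-≤ a≤ (proj₁ (fib-shift-differFirstAt (2 + m)))) (fib-per1 n))
          (differFirstAt-cong per1-differFirstAt
            (λ i i< → sym (trans (cong fib (sym (+-assoc (F (5 + m)) a i)))
                                 (proj₁ (fib-shift-differFirstAt (3 + m)) i (<-≤-trans i< a+ℓ<))))
            (λ i _ → sym (per1-periodic n 0<a i))))
        (λ _ _ → refl)
        (λ j _ → sym (per2-shift n j)))
    where
    a≤ : a ≤ F (6 + m) ∸ 2
    a≤ = subst (a ≤_) (sym (+-∸-comm a (2≤F[3+k] (2 + m)))) (m≤n+m a (F (5 + m) ∸ 2))
    a+ℓ< : a + ℓ < F (7 + m) ∸ 2
    a+ℓ< = subst (a + ℓ <_) (sym (+-∸-assoc (F (6 + m)) (2≤F[3+k] (2 + m))))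
             (+-monoˡ-< ℓ (m<n+m a (1≤F[1+k] (4 + m))))

  word2-prefixOf : PrefixOf (word2 n) (per2 n)
  word2-prefixOf =
    prefixOf-++ (pref (F (5 + m))) (pref a ++ word1 n) (length-pref (F (5 + m)))
      (pref-prefixOf (F (5 + m)) (fib-per2 n))
      (agreeBelow-trans
        (prefixOf-++-periodic (pref a) (word1 n) (length-pref a) (per1-periodic n 0<a)
          (pref-prefixOf a (fib-per1 n)) word1-prefixOf)
        (λ j _ → sym (per2-shift n j)))

  length-word2 : length (word2 n) ≡ F (5 + m) + (a + (a + ℓ))
  length-word2 = begin
    length (word2 n)
      ≡⟨ length-++ (pref (F (5 + m))) ⟩
    length (pref (F (5 + m))) + length (pref a ++ word1 n)
      ≡⟨ cong₂ _+_ (length-pref (F (5 + m))) (length-++ (pref a)) ⟩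
    F (5 + m) + (length (pref a) + length (word1 n))
      ≡⟨ cong (F (5 + m) +_) (cong₂ _+_ (length-pref a) length-word1) ⟩
    F (5 + m) + (a + (a + ℓ))
      ∎

  word1-isLCP : IsLCP fib (per1 n) (word1 n)
  word1-isLCP = isLCP (word1 n) word1-prefixOf
    (subst (DifferFirstAt fib (per1 n)) (sym length-word1) per1-differFirstAt)

  word2-isLCP : IsLCP fib (per2 n) (word2 n)
  word2-isLCP = isLCP (word2 n) word2-prefixOf
    (subst (DifferFirstAt fib (per2 n)) (sym length-word2) per2-differFirstAt)

  length-word1-closed : length (word1 n) ≡ F (6 + m) ∸ 2
  length-word1-closed = trans length-word1 (F-add-∸2 (2 + m))

  length-word2-closed : length (word2 n) ≡ 2 * F (6 + m) ∸ 2
  length-word2-closed = begin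
    length (word2 n)                        ≡⟨ length-word2 ⟩
    F (5 + m) + (a + (a + ℓ))               ≡⟨ +-assoc (F (5 + m)) a (a + ℓ) ⟨
    F (6 + m) + (a + ℓ)                     ≡⟨ cong (F (6 + m) +_) (F-add-∸2 (2 + m)) ⟩
    F (6 + m) + (F (6 + m) ∸ 2)             ≡⟨ x+[x∸2]≡2x∸2 (2≤F[3+k] (3 + m)) ⟩
    2 * F (6 + m) ∸ 2                       ∎

proposition7p2 : (n : ℕ) → 4 ≤ n →
    (IsLCP fib (per1 n) (word1 n) × length (word1 n) ≡ F (suc (suc n)) ∸ 2)
    × (IsLCP fib (per2 n) (word2 n) × length (word2 n) ≡ 2 * F (suc (suc n)) ∸ 2)
proposition7p2 n 4≤n with m≤n⇒∃[o]m+o≡n 4≤n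
... | m , refl = (word1-isLCP m , length-word1-closed m) , (word2-isLCP m , length-word2-closed m)
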